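{- Let $\Gamma=(V,E)$ be a finite connected regular graph, $G\le\mathrm{Aut}\,\Gamma$ transitive on $V$, $N\ne1$ a normal subgroup of $G$ that is intransitive on $V$, and $\Delta$ a union of some $G$-orbits on the arc set of $\Gamma$, regarded as a digraph on $V$, and assume $\Delta$ is connected. If $|\Delta(\alpha)|=|\Delta_N(B)|$ for some $N$-orbit $B$ and some $\alpha\in B$, then $N$ is semiregular on $V$, that is, $N_\alpha=1$.
   Context: Arcs of $\Gamma$ are ordered pairs $(\alpha,\beta)$ with $\{\alpha,\beta\}\in E$; $\Delta(\alpha)=\{\beta\mid(\alpha,\beta)\in\Delta\}$. $\Delta_N$ is the digraph on the set of $N$-orbits on $V$ in which $(B,C)$ is an arc iff $B\ne C$ and $(\delta,\gamma)\in\Delta$ for some $\delta\in B$, $\gamma\in C$; $\Delta_N(B)$ is the set of out-neighbours of $B$ in $\Delta_N$. $N_\alpha$ is the stabilizer of $\alpha$ in $N$. -}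

module Defs where

open import Data.Nat using (ℕ)
open import Data.Bool using (Bool; true; false; T)
open import Data.Fin using (Fin; _<_)
open import Data.Fin.Properties using (any?; all?; _≟_; _<?_)
open import Data.Fin.Permutation using (Permutation′; _⟨$⟩ʳ_; id; flip; _∘ₚ_)
open import Data.Fin.Subset using (∣_∣)
open import Data.Vec using (tabulate)
open import Data.List using (List)
open import Data.List.Relation.Unary.Any using (Any)
  renaming (any? to anyL?)
open import Data.Product using (Σ; ∃; _×_; _,_)
open import Relation.Binary.PropositionalEquality using (_≡_; _≢_)
open import Relation.Binary.Construct.Closure.ReflexiveTransitive using (Star)
open import Relation.Binary.Construct.Closure.Symmetric using (SymClosure)
open import Relation.Nullary using (¬_; Dec; does; yes; no)
open import Relation.Nullary.Decidable using (_×-dec_; ¬?; _→-dec_; T?)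

count : ∀ {n} → (Fin n → Bool) → ℕ
count f = ∣ tabulate f ∣

-- A finite permutation group on Fin n is represented by a list of its
-- elements.  Membership is up to pointwise equality of permutations.
_∈ᴾ_ : ∀ {n} → Permutation′ n → List (Permutation′ n) → Set
g ∈ᴾ Gs = Any (λ h → ∀ x → h ⟨$⟩ʳ x ≡ g ⟨$⟩ʳ x) Gs

record IsPermGroup {n} (Gs : List (Permutation′ n)) : Set where
  field
    has-id  : id ∈ᴾ Gs
    closed  : ∀ g h → g ∈ᴾ Gs → h ∈ᴾ Gs → (g ∘ₚ h) ∈ᴾ Gs
    inverse : ∀ g → g ∈ᴾ Gs → flip g ∈ᴾ Gs

record IsNormalSubgroup {n} (Ns Gs : List (Permutation′ n)) : Set where
  field
    isGroup : IsPermGroup Ns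
    sub     : ∀ h → h ∈ᴾ Ns → h ∈ᴾ Gs
    normal  : ∀ g h → g ∈ᴾ Gs → h ∈ᴾ Ns → ((flip g ∘ₚ h) ∘ₚ g) ∈ᴾ Ns

record IsSimpleGraph {n} (adj : Fin n → Fin n → Bool) : Set where
  field
    sym   : ∀ x y → adj x y ≡ adj y x
    irrefl : ∀ x → adj x x ≡ false

Connected : ∀ {n} → (Fin n → Fin n → Bool) → Set
Connected {n} adj = ∀ (x y : Fin n) → Star (λ a b → T (adj a b)) x y

WeaklyConnected : ∀ {n} → (Fin n → Fin n → Bool) → Set
WeaklyConnected {n} Δ =
  ∀ (x y : Fin n) → Star (SymClosure (λ a b → T (Δ a b))) x y

Regular : ∀ {n} → (Fin n → Fin n → Bool) → Set
Regular adj = ∃ λ k → ∀ x → count (adj x) ≡ k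

Automorphisms : ∀ {n} → (Fin n → Fin n → Bool) → List (Permutation′ n) → Set
Automorphisms adj Gs = ∀ g → g ∈ᴾ Gs → ∀ x y → adj (g ⟨$⟩ʳ x) (g ⟨$⟩ʳ y) ≡ adj x y

InOrbit : ∀ {n} → List (Permutation′ n) → Fin n → Fin n → Set
InOrbit Gs x y = Any (λ h → h ⟨$⟩ʳ x ≡ y) Gs

inOrbit? : ∀ {n} (Gs : List (Permutation′ n)) x y → Dec (InOrbit Gs x y)
inOrbit? Gs x y = anyL? (λ h → h ⟨$⟩ʳ x ≟ y) Gs

Transitive : ∀ {n} → List (Permutation′ n) → Set
Transitive Gs = ∀ x y → InOrbit Gs x y

-- Δ (a set of arcs of Γ) is a union of G-orbits on arcs: it consists of
-- arcs of Γ and is G-invariant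
UnionOfArcOrbits : ∀ {n} → (Fin n → Fin n → Bool) → List (Permutation′ n)
                   → (Fin n → Fin n → Bool) → Set
UnionOfArcOrbits adj Gs Δ =
  (∀ x y → T (Δ x y) → T (adj x y)) ×
  (∀ g → g ∈ᴾ Gs → ∀ x y → Δ (g ⟨$⟩ʳ x) (g ⟨$⟩ʳ y) ≡ Δ x y)

outDeg : ∀ {n} → (Fin n → Fin n → Bool) → Fin n → ℕ
outDeg Δ α = count (Δ α)

IsRep : ∀ {n} → List (Permutation′ n) → Fin n → Set
IsRep Ns γ = ∀ z → z < γ → ¬ InOrbit Ns z γ

isRep? : ∀ {n} (Ns : List (Permutation′ n)) γ → Dec (IsRep Ns γ)
isRep? Ns γ = all? (λ z → (z <? γ) →-dec ¬? (inOrbit? Ns z γ))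

-- (B , C) is an arc of Δ_N, where B = α^N and C = γ^N:
-- B ≠ C and (δ , γ') ∈ Δ for some δ ∈ B, γ' ∈ C
QuotArc : ∀ {n} → (Fin n → Fin n → Bool) → List (Permutation′ n)
          → Fin n → Fin n → Set
QuotArc Δ Ns α γ =
  ¬ InOrbit Ns α γ ×
  ∃ λ δ → InOrbit Ns α δ × ∃ λ γ′ → InOrbit Ns γ γ′ × T (Δ δ γ′)

quotArc? : ∀ {n} Δ (Ns : List (Permutation′ n)) α γ → Dec (QuotArc Δ Ns α γ)
quotArc? Δ Ns α γ =
  ¬? (inOrbit? Ns α γ) ×-dec
  any? (λ δ → inOrbit? Ns α δ ×-dec any? (λ γ′ → inOrbit? Ns γ γ′ ×-dec T? (Δ δ γ′)))

-- |Δ_N(B)| for B = α^N : the number of N-orbits C that are out-neighbours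
-- of B in Δ_N, each orbit counted once via its least element
quotOutDeg : ∀ {n} → (Fin n → Fin n → Bool) → List (Permutation′ n) → Fin n → ℕ
quotOutDeg Δ Ns α = count (λ γ → does (isRep? Ns γ ×-dec quotArc? Δ Ns α γ))

Semiregular : ∀ {n} → List (Permutation′ n) → Set
Semiregular {n} Ns = ∀ h → h ∈ᴾ Ns → ∀ (β : Fin n) → h ⟨$⟩ʳ β ≡ β → ∀ x → h ⟨$⟩ʳ x ≡ x

module Submission where

-- Write B = α^N.  Every arc (B, C) of Δ_N is witnessed by an
-- out-neighbour of α itself: if (α^k, γ′) ∈ Δ with k ∈ N then
-- (α, γ′^(k⁻¹)) ∈ Δ by N-invariance.  Choosing such a witness in every
-- out-neighbour C of B gives an injection Δ_N(B) → Δ(α); as both sets have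
-- the same size it is onto, so Δ(α) meets every N-orbit in at most one
-- point.  Since N_α permutes Δ(α) and preserves N-orbits, N_α fixes Δ(α)
-- pointwise.  Conjugating by the transitive group G, which normalises N,
-- the same holds at every vertex: the fixed-point set of any h ∈ N is
-- closed under out-neighbours.  In a finite vertex-transitive digraph every
-- arc (γ, β) lies on a directed cycle (iterate some g ∈ G with γ^g = β), so
-- that set is also closed under in-neighbours, and weak connectivity of Δ
-- spreads a fixed point of h to all vertices.

open import Defs
open import Data.Nat using (ℕ; zero; suc; _+_; _≤_; _<_; z≤n; s≤s)
open import Data.Nat.Properties using (≤-trans; ≤-<-trans; ≤-reflexive; <-irrefl; n<1+n; +-suc; m≤n⇒∃[o]m+o≡n)
open import Data.Bool using (Bool; true; false; T)
open import Data.Empty using (⊥-elim)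
open import Data.Fin using (Fin; toℕ)
import Data.Fin as F
open import Data.Fin.Properties using (_≟_; any?; <-cmp; pigeonhole)
open import Data.Fin.Permutation using (Permutation′; _⟨$⟩ʳ_; _⟨$⟩ˡ_; flip; _∘ₚ_; inverseˡ; inverseʳ)
open import Data.Fin.Subset using (∣_∣)
import Data.Vec as Vec
open import Data.List using (List; []; _∷_; length; filter; allFin; tabulate)
open import Data.List.Relation.Unary.Any as Any using (here; there)
open import Data.List.Relation.Unary.All as All using ()
open import Data.List.Relation.Unary.AllPairs using (_∷_)
open import Data.List.Relation.Unary.Unique.Propositional using (Unique)
open import Data.List.Relation.Unary.Unique.Propositional.Properties using (filter⁺; allFin⁺)
open import Data.List.Membership.Propositional using (_∈_; find)
open import Data.List.Membership.Propositional.Properties using (∈-filter⁺; ∈-filter⁻; ∈-allFin)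
open import Data.List.Properties using (filter-notAll)
open import Data.Product using (∃; _×_; _,_; proj₁; proj₂)
open import Relation.Binary.Definitions using (DecidableEquality; tri<; tri≈; tri>)
open import Relation.Binary.PropositionalEquality using (_≡_; refl; sym; trans; cong; subst; module ≡-Reasoning)
open import Relation.Binary.Construct.Closure.ReflexiveTransitive using (Star; ε; _◅_)
open import Relation.Binary.Construct.Closure.Symmetric using (SymClosure; fwd; bwd)
open import Relation.Nullary using (¬_; Dec; yes; no; does)
open import Relation.Nullary.Decidable using (_×-dec_; ¬?; T?)
open import Function using (_∘_)

from-does : ∀ {p} {P : Set p} (d : Dec P) → T (does d) → P
from-does (yes p) _ = p
from-does (no _) ()

enum : ∀ {n} → (Fin n → Bool) → List (Fin n)
enum {n} f = filter (T? ∘ f) (allFin n)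

count-tabulate : ∀ {m k} (f : Fin k → Bool) (h : Fin m → Fin k) →
                 ∣ Vec.tabulate (f ∘ h) ∣ ≡ length (filter (T? ∘ f) (tabulate h))
count-tabulate {zero} f h = refl
count-tabulate {suc m} f h with f (h F.zero)
... | true  = cong suc (count-tabulate f (h ∘ F.suc))
... | false = count-tabulate f (h ∘ F.suc)

count≡length-enum : ∀ {n} (f : Fin n → Bool) → count f ≡ length (enum f)
count≡length-enum f = count-tabulate f (λ i → i)

enum-unique : ∀ {n} (f : Fin n → Bool) → Unique (enum f)
enum-unique {n} f = filter⁺ (T? ∘ f) (allFin⁺ n)

∈-enum⁺ : ∀ {n} (f : Fin n → Bool) {x} → T (f x) → x ∈ enum f
∈-enum⁺ f {x} fx = ∈-filter⁺ (T? ∘ f) (∈-allFin x) fx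

∈-enum⁻ : ∀ {n} (f : Fin n → Bool) {x} → x ∈ enum f → T (f x)
∈-enum⁻ {n} f x∈ = proj₂ (∈-filter⁻ (T? ∘ f) {xs = allFin n} x∈)

-- A map injective on a duplicate-free list xs and sending it into ys
-- cannot make xs longer than ys; if ys is not longer than xs, the map is
-- onto ys.  This is the finite counting behind "equal sizes force a
-- bijection".
module Injection {a b} {A : Set a} {B : Set b}
                 (_≟B_ : DecidableEquality B) (s : A → B) where

  MapsInto : List A → List B → Set _
  MapsInto xs ys = ∀ {x} → x ∈ xs → s x ∈ ys

  InjectiveOn : List A → Set _
  InjectiveOn xs = ∀ {x y} → x ∈ xs → y ∈ xs → s x ≡ s y → x ≡ y

  -- Removing the image of the head from ys shortens ys, which pays for it.
  length-≤ : ∀ {xs ys} → Unique xs → MapsInto xs ys → InjectiveOn xs →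
             length xs ≤ length ys
  length-≤ {[]} _ _ _ = z≤n
  length-≤ {x ∷ xs} {ys} (x∉xs ∷ xs-unique) into injective =
    ≤-trans (s≤s rest) (filter-notAll other? ys (Any.map (λ e ne → ne (sym e)) (into (here refl))))
    where
    other? = λ y → ¬? (y ≟B s x)
    rest : length xs ≤ length (filter other? ys)
    rest = length-≤ xs-unique
      (λ x′∈ → ∈-filter⁺ other? (into (there x′∈))
                 (λ e → All.lookup x∉xs x′∈ (sym (injective (there x′∈) (here refl) e))))
      (λ x′∈ x″∈ → injective (there x′∈) (there x″∈))

  -- If y were missed, xs would map into ys without y, which is shorter.
  onto : ∀ {xs ys} → Unique xs → MapsInto xs ys → InjectiveOn xs →
         length ys ≤ length xs → ∀ {y} → y ∈ ys → ∃ λ x → x ∈ xs × s x ≡ y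
  onto {xs} {ys} xs-unique into injective ys≤xs {y} y∈ys
    with Any.any? (λ x → s x ≟B y) xs
  ... | yes hit = find hit
  ... | no miss = ⊥-elim (<-irrefl refl (≤-<-trans ys≤xs (≤-<-trans xs≤rest rest<ys)))
    where
    other? = λ z → ¬? (z ≟B y)
    xs≤rest : length xs ≤ length (filter other? ys)
    xs≤rest = length-≤ xs-unique
      (λ x∈ → ∈-filter⁺ other? (into x∈) (λ e → miss (Any.map (λ { refl → e }) x∈)))
      injective
    rest<ys : length (filter other? ys) < length ys
    rest<ys = filter-notAll other? ys (Any.map (λ e ne → ne (sym e)) y∈ys)

witness : ∀ {n} {Hs : List (Permutation′ n)} {x y} → InOrbit Hs x y →
          ∃ λ h → h ∈ᴾ Hs × h ⟨$⟩ʳ x ≡ y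
witness o with find o
... | h , h∈ , hx≡y = h , Any.map (λ { refl _ → refl }) h∈ , hx≡y

orbit-by : ∀ {n} {Hs : List (Permutation′ n)} {x y} h → h ∈ᴾ Hs → h ⟨$⟩ʳ x ≡ y →
           InOrbit Hs x y
orbit-by {x = x} h h∈ hx≡y = Any.map (λ e → trans (e x) hx≡y) h∈

module Orbits {n} {Hs : List (Permutation′ n)} (H : IsPermGroup Hs) where
  open IsPermGroup H

  orbit-sym : ∀ {x y} → InOrbit Hs x y → InOrbit Hs y x
  orbit-sym o with witness o
  ... | h , h∈ , refl = orbit-by (flip h) (inverse h h∈) (inverseˡ h)

  orbit-trans : ∀ {x y z} → InOrbit Hs x y → InOrbit Hs y z → InOrbit Hs x z
  orbit-trans o o′ with witness o | witness o′
  ... | h , h∈ , refl | k , k∈ , refl = orbit-by (h ∘ₚ k) (closed h k h∈ k∈) refl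

  rep-unique : ∀ {x y} → IsRep Hs x → IsRep Hs y → InOrbit Hs x y → x ≡ y
  rep-unique {x} {y} x-rep y-rep o with <-cmp x y
  ... | tri< x<y _ _ = ⊥-elim (y-rep x x<y o)
  ... | tri≈ _ x≡y _ = x≡y
  ... | tri> _ _ y<x = ⊥-elim (x-rep y y<x (orbit-sym o))

Invariant : ∀ {n} → (Fin n → Fin n → Bool) → List (Permutation′ n) → Set
Invariant Δ Hs = ∀ g → g ∈ᴾ Hs → ∀ x y → Δ (g ⟨$⟩ʳ x) (g ⟨$⟩ʳ y) ≡ Δ x y

arc-image : ∀ {n} {Δ : Fin n → Fin n → Bool} {Hs} → Invariant Δ Hs →
            ∀ g → g ∈ᴾ Hs → ∀ {x y} → T (Δ x y) → T (Δ (g ⟨$⟩ʳ x) (g ⟨$⟩ʳ y))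
arc-image inv g g∈ {x} {y} = subst T (sym (inv g g∈ x y))

StabiliserFixesOut : ∀ {n} → List (Permutation′ n) → (Fin n → Fin n → Bool) → Fin n → Set
StabiliserFixesOut Ns Δ β =
  ∀ h → h ∈ᴾ Ns → h ⟨$⟩ʳ β ≡ β → ∀ γ → T (Δ β γ) → h ⟨$⟩ʳ γ ≡ γ

module AtVertex {n} {Ns : List (Permutation′ n)} (N : IsPermGroup Ns)
                {Δ : Fin n → Fin n → Bool} (Δ-inv : Invariant Δ Ns) (α : Fin n) where
  open IsPermGroup N
  open Orbits N

  quot-arc-from-α : ∀ {γ} → QuotArc Δ Ns α γ → ∃ λ β → T (Δ α β) × InOrbit Ns γ β
  quot-arc-from-α (_ , δ , αNδ , γ′ , γNγ′ , δγ′) with witness αNδ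
  ... | k , k∈ , refl =
    k ⟨$⟩ˡ γ′ , α→ , orbit-trans γNγ′ (orbit-by (flip k) (inverse k k∈) refl)
    where
    α→ : T (Δ α (k ⟨$⟩ˡ γ′))
    α→ = subst (λ z → T (Δ z (k ⟨$⟩ˡ γ′))) (inverseˡ k) (arc-image Δ-inv (flip k) (inverse k k∈) δγ′)

  -- A chosen out-neighbour of α in the N-orbit of γ (γ itself if none).
  select : Fin n → Fin n
  select γ with any? (λ β → T? (Δ α β) ×-dec inOrbit? Ns γ β)
  ... | yes (β , _) = β
  ... | no _        = γ

  select-spec : ∀ {γ} → QuotArc Δ Ns α γ → T (Δ α (select γ)) × InOrbit Ns γ (select γ)
  select-spec {γ} q with any? (λ β → T? (Δ α β) ×-dec inOrbit? Ns γ β)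
  ... | yes (_ , spec) = spec
  ... | no none        = ⊥-elim (none (quot-arc-from-α q))

  IsQuotNbr : Fin n → Bool
  IsQuotNbr γ = does (isRep? Ns γ ×-dec quotArc? Δ Ns α γ)

  quot-nbr : ∀ {γ} → T (IsQuotNbr γ) → IsRep Ns γ × QuotArc Δ Ns α γ
  quot-nbr {γ} = from-does (isRep? Ns γ ×-dec quotArc? Δ Ns α γ)

  select-orbit : ∀ {γ} → T (IsQuotNbr γ) → InOrbit Ns γ (select γ)
  select-orbit γ-nbr = proj₂ (select-spec (proj₂ (quot-nbr γ-nbr)))

  open Injection _≟_ select

  -- select maps Δ_N(α^N) into Δ(α), injectively since distinct
  -- representatives lie in distinct N-orbits.
  select-into : MapsInto (enum IsQuotNbr) (enum (Δ α))
  select-into γ∈ = ∈-enum⁺ (Δ α) (proj₁ (select-spec (proj₂ (quot-nbr (∈-enum⁻ IsQuotNbr γ∈)))))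

  select-injective : InjectiveOn (enum IsQuotNbr)
  select-injective {γ} {γ′} γ∈ γ′∈ same =
    rep-unique (proj₁ (quot-nbr γ-nbr)) (proj₁ (quot-nbr γ′-nbr))
      (orbit-trans (select-orbit γ-nbr)
        (subst (λ z → InOrbit Ns z γ′) (sym same) (orbit-sym (select-orbit γ′-nbr))))
    where
    γ-nbr  = ∈-enum⁻ IsQuotNbr γ∈
    γ′-nbr = ∈-enum⁻ IsQuotNbr γ′∈

  module _ (deg : outDeg Δ α ≡ quotOutDeg Δ Ns α) where

    selected : ∀ {β} → T (Δ α β) → ∃ λ γ → T (IsQuotNbr γ) × select γ ≡ β
    selected β∈ with onto (enum-unique IsQuotNbr) select-into select-injective sizes
                          (∈-enum⁺ (Δ α) β∈)
      where
      open ≡-Reasoning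
      sizes : length (enum (Δ α)) ≤ length (enum IsQuotNbr)
      sizes = ≤-reflexive (begin
        length (enum (Δ α))     ≡⟨ sym (count≡length-enum (Δ α)) ⟩
        outDeg Δ α              ≡⟨ deg ⟩
        quotOutDeg Δ Ns α       ≡⟨ count≡length-enum IsQuotNbr ⟩
        length (enum IsQuotNbr) ∎)
    ... | γ , γ∈ , select≡β = γ , ∈-enum⁻ IsQuotNbr γ∈ , select≡β

    one-per-orbit : ∀ {β β′} → T (Δ α β) → T (Δ α β′) → InOrbit Ns β β′ → β ≡ β′
    one-per-orbit β∈ β′∈ o with selected β∈ | selected β′∈
    ... | γ , γ-nbr , refl | γ′ , γ′-nbr , refl =
      cong select (rep-unique (proj₁ (quot-nbr γ-nbr)) (proj₁ (quot-nbr γ′-nbr))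
        (orbit-trans (select-orbit γ-nbr) (orbit-trans o (orbit-sym (select-orbit γ′-nbr)))))

    -- N_α permutes Δ(α) within N-orbits, so it fixes Δ(α) pointwise.
    stabiliser-fixes-out : StabiliserFixesOut Ns Δ α
    stabiliser-fixes-out h h∈ hα β β∈ = sym (one-per-orbit β∈ hβ∈ (orbit-by h h∈ refl))
      where
      hβ∈ : T (Δ α (h ⟨$⟩ʳ β))
      hβ∈ = subst (λ z → T (Δ z (h ⟨$⟩ʳ β))) hα (arc-image Δ-inv h h∈ β∈)

-- Conjugation by g ∈ G carries the local property from α to α^g, since G
-- normalises N and preserves Δ: for h ∈ N_(α^g), g h g⁻¹ lies in N_α.
stabiliser-fixes-out-image :
  ∀ {n} {Gs Ns : List (Permutation′ n)} {Δ : Fin n → Fin n → Bool} →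
  IsPermGroup Gs → IsNormalSubgroup Ns Gs → Invariant Δ Gs →
  ∀ {α} g → g ∈ᴾ Gs → StabiliserFixesOut Ns Δ α → StabiliserFixesOut Ns Δ (g ⟨$⟩ʳ α)
stabiliser-fixes-out-image {Ns = Ns} {Δ = Δ} G N◁G Δ-inv {α} g g∈ fixes-α h h∈ hgα γ gαγ =
  begin
    h ⟨$⟩ʳ γ                                     ≡⟨ sym (inverseʳ g) ⟩
    g ⟨$⟩ʳ (g ⟨$⟩ˡ (h ⟨$⟩ʳ γ))                   ≡⟨ cong (λ z → g ⟨$⟩ʳ (g ⟨$⟩ˡ (h ⟨$⟩ʳ z))) (sym (inverseʳ g)) ⟩
    g ⟨$⟩ʳ (conj ⟨$⟩ʳ (g ⟨$⟩ˡ γ))                ≡⟨ cong (g ⟨$⟩ʳ_) (fixes-α conj conj∈ conj-α (g ⟨$⟩ˡ γ) α-arc) ⟩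
    g ⟨$⟩ʳ (g ⟨$⟩ˡ γ)                            ≡⟨ inverseʳ g ⟩
    γ                                            ∎
  where
  open ≡-Reasoning
  g⁻¹∈ = IsPermGroup.inverse G g g∈
  conj : Permutation′ _
  conj = (flip (flip g) ∘ₚ h) ∘ₚ flip g
  conj∈ : conj ∈ᴾ Ns
  conj∈ = IsNormalSubgroup.normal N◁G (flip g) h g⁻¹∈ h∈
  conj-α : conj ⟨$⟩ʳ α ≡ α
  conj-α = trans (cong (g ⟨$⟩ˡ_) hgα) (inverseˡ g)
  α-arc : T (Δ α (g ⟨$⟩ˡ γ))
  α-arc = subst (λ z → T (Δ z (g ⟨$⟩ˡ γ))) (inverseˡ g) (arc-image Δ-inv (flip g) g⁻¹∈ gαγ)

stabiliser-fixes-out-everywhere :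
  ∀ {n} {Gs Ns : List (Permutation′ n)} {Δ : Fin n → Fin n → Bool} →
  IsPermGroup Gs → IsNormalSubgroup Ns Gs → Invariant Δ Gs → Transitive Gs →
  ∀ {α} → StabiliserFixesOut Ns Δ α → ∀ β → StabiliserFixesOut Ns Δ β
stabiliser-fixes-out-everywhere G N◁G Δ-inv G-transitive {α} fixes-α β
  with witness (G-transitive α β)
... | g , g∈ , refl = stabiliser-fixes-out-image G N◁G Δ-inv g g∈ fixes-α

iterate : ∀ {n} → Permutation′ n → ℕ → Fin n → Fin n
iterate g zero    x = x
iterate g (suc k) x = g ⟨$⟩ʳ iterate g k x

iterate-+ : ∀ {n} (g : Permutation′ n) i k x →
            iterate g (i + k) x ≡ iterate g i (iterate g k x)
iterate-+ g zero    k x = refl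
iterate-+ g (suc i) k x = cong (g ⟨$⟩ʳ_) (iterate-+ g i k x)

iterate-injective : ∀ {n} (g : Permutation′ n) i {x y} →
                    iterate g i x ≡ iterate g i y → x ≡ y
iterate-injective g zero    same = same
iterate-injective g (suc i) {x} {y} same =
  iterate-injective g i (trans (sym (inverseˡ g)) (trans (cong (g ⟨$⟩ˡ_) same) (inverseˡ g)))

-- Every point of Fin n lies on a cycle of g: by pigeonhole two of the
-- iterates x, x^g, …, x^(g^n) agree, and iterates are injective.
returns : ∀ {n} (g : Permutation′ n) x → ∃ λ k → iterate g (suc k) x ≡ x
returns {n} g x with pigeonhole (n<1+n n) (λ i → iterate g (toℕ i) x)
... | i , j , i<j , same with m≤n⇒∃[o]m+o≡n i<j
... | k , i+1+k≡j = k , sym (iterate-injective g (toℕ i) (begin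
    iterate g (toℕ i) x                         ≡⟨ same ⟩
    iterate g (toℕ j) x                         ≡⟨ cong (λ m → iterate g m x) (sym i+1+k≡j) ⟩
    iterate g (suc (toℕ i) + k) x               ≡⟨ cong (λ m → iterate g m x) (sym (+-suc (toℕ i) k)) ⟩
    iterate g (toℕ i + suc k) x                 ≡⟨ iterate-+ g (toℕ i) (suc k) x ⟩
    iterate g (toℕ i) (iterate g (suc k) x)     ∎))
  where open ≡-Reasoning

-- In a finite digraph with a vertex-transitive group of automorphisms every
-- arc (γ, β) lies on a directed cycle γ, γ^g = β, γ^(g²), …, γ; hence a set
-- closed under out-neighbours is also closed under in-neighbours.
in-closed : ∀ {n p} {Gs : List (Permutation′ n)} {Δ : Fin n → Fin n → Bool} →
            Invariant Δ Gs → Transitive Gs → (P : Fin n → Set p) →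
            (∀ {β γ} → P β → T (Δ β γ) → P γ) →
            ∀ {β γ} → P β → T (Δ γ β) → P γ
in-closed {Δ = Δ} Δ-inv G-transitive P out-closed {β} {γ} Pβ γβ with witness (G-transitive γ β)
... | g , g∈ , refl with returns g γ
... | k , cycle = subst P cycle (along-cycle k)
  where
  arc : ∀ k → T (Δ (iterate g k γ) (iterate g (suc k) γ))
  arc zero    = γβ
  arc (suc k) = arc-image Δ-inv g g∈ (arc k)
  along-cycle : ∀ k → P (iterate g (suc k) γ)
  along-cycle zero    = Pβ
  along-cycle (suc k) = out-closed (along-cycle k) (arc (suc k))

along-walks : ∀ {a ℓ p} {A : Set a} {R : A → A → Set ℓ} (P : A → Set p) →
              (∀ {x y} → P x → R x y → P y) → (∀ {x y} → P x → R y x → P y) →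
              ∀ {x y} → Star (SymClosure R) x y → P x → P y
along-walks P out-closed in-closed ε            Px = Px
along-walks P out-closed in-closed (fwd r ◅ rs) Px = along-walks P out-closed in-closed rs (out-closed Px r)
along-walks P out-closed in-closed (bwd r ◅ rs) Px = along-walks P out-closed in-closed rs (in-closed Px r)

lemma2p4 : ∀ {n : ℕ} (adj : Fin n → Fin n → Bool) (Gs Ns : List (Permutation′ n))
    (Δ : Fin n → Fin n → Bool) →
    IsSimpleGraph adj → Connected adj → Regular adj →
    IsPermGroup Gs → Automorphisms adj Gs → Transitive Gs →
    IsNormalSubgroup Ns Gs →
    (∃ λ h → h ∈ᴾ Ns × ¬ (∀ x → h ⟨$⟩ʳ x ≡ x)) →
    ¬ Transitive Ns →
    UnionOfArcOrbits adj Gs Δ → WeaklyConnected Δ →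
    (α : Fin n) → outDeg Δ α ≡ quotOutDeg Δ Ns α →
    Semiregular Ns
lemma2p4 adj Gs Ns Δ _ _ _ G _ G-transitive N◁G _ _ (_ , Δ-inv) Δ-connected α deg h h∈ β hβ x =
  along-walks Fixed out-closed (in-closed Δ-inv G-transitive Fixed out-closed) (Δ-connected β x) hβ
  where
  open IsNormalSubgroup N◁G using (isGroup; sub)
  Fixed : Fin _ → Set
  Fixed y = h ⟨$⟩ʳ y ≡ y
  fixes-out-α : StabiliserFixesOut Ns Δ α
  fixes-out-α = AtVertex.stabiliser-fixes-out isGroup (λ g g∈ → Δ-inv g (sub g g∈)) α deg
  out-closed : ∀ {y z} → Fixed y → T (Δ y z) → Fixed z
  out-closed {y} {z} hy yz =
    stabiliser-fixes-out-everywhere G N◁G Δ-inv G-transitive fixes-out-α y h h∈ hy z yz
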